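{- For any cut $S\subseteq V$ of $G$, the following two minima are equal: (1) the minimum of $\sum_{v\in D}d_v$ over all sets $D\subseteq\bigsqcup_{j}V_j$ such that the symmetric difference $\triangle_{v\in D}\overline v$ equals $S$, where $d_v=d^W_{G_j}(v)$ for the index $j$ with $v\in V_j$; (2) the minimum of $\partial_XS^*$ (the total weight of edges of $X$ with exactly one endpoint in $S^*$) over all $S^*\subseteq V_X$ with $S^*\cap V=S$.
   Context: $G=(V,E,w)$ is an undirected weighted graph. Let $G_0=G,G_1,\dots,G_L$ with vertex sets $V_0=V,V_1,\dots,V_L$ be a sequence of graphs in which each $G_{j+1}$ is obtained from $G_j$ by contracting each set of a partition of $V_j$ into a single vertex, and $G_L$ has a single vertex. The sets $V_j$ are regarded as pairwise disjoint (a vertex of $V_j$ and one of $V_{j+1}$ are different objects even if nothing was contracted). For $v\in V_j$, $\overline v\subseteq V$ is the set of original vertices contracted into $v$. $d^W_{G_j}(v)$ denotes the weighted degree of $v$ in $G_j$. The graph $X=(V_X,E_X)$ has a vertex $x^j_v$ for each $j\in\{0,\dots,L\}$ and $v\in V_j$, where $x^0_v$ is identified with the original vertex $v\in V$ (so $V\subseteq V_X$); for each $j\in\{0,\dots,L-1\}$ and $u\in V_j$, with $v\in V_{j+1}$ the vertex $u$ contracts to, $X$ has an edge $(x^j_u,x^{j+1}_v)$ of weight $d^W_{G_j}(u)$; $X$ has no other edges.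
   Formalization: The edge weights w of G are rational, so the weighted degrees $d^W_{G_j}(v)$ and both minima are taken over the rationals. -}

module Defs where

open import Data.Nat using (ℕ; zero; suc; _<_)
open import Data.Fin using (Fin; zero; suc; _≟_)
open import Data.Bool using (Bool; true; false; if_then_else_; _xor_; _∧_; not)
open import Data.Rational using (ℚ; 0ℚ; _+_; _≤_)
open import Data.Product using (Σ; ∃; _×_; _,_)
open import Relation.Nullary.Decidable using (⌊_⌋)
open import Relation.Binary.PropositionalEquality using (_≡_)
open import Function using (_∘_)

sumFin : (m : ℕ) → (Fin m → ℚ) → ℚ
sumFin zero    f = 0ℚ
sumFin (suc m) f = f zero + sumFin m (f ∘ suc)

sumUpTo : ℕ → (ℕ → ℚ) → ℚ
sumUpTo zero    f = 0ℚ
sumUpTo (suc m) f = sumUpTo m f + f m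

xorFin : (m : ℕ) → (Fin m → Bool) → Bool
xorFin zero    f = false
xorFin (suc m) f = f zero xor xorFin m (f ∘ suc)

xorUpTo : ℕ → (ℕ → Bool) → Bool
xorUpTo zero    f = false
xorUpTo (suc m) f = xorUpTo m f xor f m

ind : Bool → ℚ → ℚ
ind b q = if b then q else 0ℚ

_≡ᵇ_ : ∀ {m} → Fin m → Fin m → Bool
a ≡ᵇ b = ⌊ a ≟ b ⌋

_≢ᵇ_ : ∀ {m} → Fin m → Fin m → Bool
a ≢ᵇ b = not (a ≡ᵇ b)

-- Level j has vertex set V_j = Fin (size j); V = V_0 = Fin (size 0).
-- π j : V_j → V_{j+1} maps each vertex to the vertex it is contracted
-- into; surjectivity for j < L means the fibres form a partition of V_j
-- into nonempty blocks.

record Hierarchy : Set where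
  field
    L      : ℕ
    size   : ℕ → ℕ
    w      : Fin (size 0) → Fin (size 0) → ℚ
    w-sym  : ∀ u v → w u v ≡ w v u
    w-nonneg : ∀ u v → 0ℚ ≤ w u v
    w-loop : ∀ v → w v v ≡ 0ℚ
    π      : (j : ℕ) → Fin (size j) → Fin (size (suc j))
    π-surj : ∀ j → j < L → ∀ (v : Fin (size (suc j))) → ∃ λ u → π j u ≡ v
    top    : size L ≡ 1

module _ (H : Hierarchy) where
  open Hierarchy H

  V : Set
  V = Fin (size 0)

  proj : (j : ℕ) → V → Fin (size j)
  proj zero    x = x
  proj (suc j) x = π j (proj j x)

  -- x ∈ v̄  (v̄ ⊆ V is the set of original vertices contracted into v)
  inBar : (j : ℕ) → Fin (size j) → V → Bool
  inBar j v x = proj j x ≡ᵇ v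

  -- edge weight of the contracted graph G_j (parallel edges merged,
  -- self-loops removed)
  wC : (j : ℕ) → Fin (size j) → Fin (size j) → ℚ
  wC j a b = ind (a ≢ᵇ b)
    (sumFin (size 0) (λ x → sumFin (size 0) (λ y →
      ind (inBar j a x ∧ inBar j b y) (w x y))))

  deg : (j : ℕ) → Fin (size j) → ℚ
  deg j a = sumFin (size j) (λ b → wC j a b)

  -- Subsets of ⊔_{j ≤ L} V_j, represented by characteristic functions;
  -- values at levels j > L are ignored.
  LevelSet : Set
  LevelSet = (j : ℕ) → Fin (size j) → Bool

  symDiff : LevelSet → V → Bool
  symDiff D x = xorUpTo (suc L) (λ j →
    xorFin (size j) (λ v → D j v ∧ inBar j v x))

  DFeasible : (V → Bool) → LevelSet → Set
  DFeasible S D = ∀ x → symDiff D x ≡ S x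

  costD : LevelSet → ℚ
  costD D = sumUpTo (suc L) (λ j →
    sumFin (size j) (λ v → ind (D j v) (deg j v)))

  SFeasible : (V → Bool) → LevelSet → Set
  SFeasible S S* = ∀ x → S* 0 x ≡ S x

  -- ∂_X S* : X has, for each j < L and u ∈ V_j, an edge
  -- (x^j_u , x^{j+1}_{π j u}) of weight d^W_{G_j}(u)
  cutX : LevelSet → ℚ
  cutX S* = sumUpTo L (λ j →
    sumFin (size j) (λ u → ind (S* j u xor S* (suc j) (π j u)) (deg j u)))

IsMin : {A : Set} → (A → Set) → (A → ℚ) → ℚ → Set
IsMin {A} P f m = (Σ A λ a → P a × f a ≡ m) × (∀ a → P a → m ≤ f a)

-- A set D of contracted vertices and a vertex set S* of X determine each other along the
-- chains x = x⁰, proj 1 x, …, proj L x: S*ⱼ(v) is the parity of D on v and its ancestors,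
-- and conversely D = {v ∈ Vⱼ | S* separates v from its parent} ∪ (S* ∩ V_L).  Under this
-- correspondence x ∈ △_{v∈D} v̄ iff x ∈ S*, and the degree d_v of v ∈ Vⱼ (j < L) is the weight
-- of the edge of X from v to its parent, which is cut exactly when v ∈ D; vertices of V_L have
-- degree 0.  So the two problems have the same feasible costs, and the second attains its
-- minimum because its free variables (the levels 1, …, L of S*) range over a finite set.
module Submission where

open import Defs
open import Data.Bool using (Bool; true; false; _xor_; _∧_)
open import Data.Bool.Properties using (xor-assoc; xor-same; xor-identityʳ; ∧-zeroʳ; ∧-identityʳ)
open import Data.Rational using (ℚ; 0ℚ; _+_; _≤_)
open import Data.Rational.Properties using (≤-total; ≤-refl; ≤-trans; ≤-reflexive; +-identityʳ)
open import Data.Product using (Σ; ∃; _×_; _,_; proj₁; proj₂)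
open import Data.Sum using (inj₁; inj₂)
open import Data.Unit using (⊤; tt)
open import Data.Nat using (ℕ; zero; suc; _<_; _∸_; _<?_; z≤n) renaming (_≤_ to _≤ℕ_; _+_ to _+ℕ_; _≟_ to _≟ℕ_)
open import Data.Nat.Properties using (<⇒≤; ≤∧≢⇒<; ≤-pred; m<n⇒m<1+n; +-suc; +-∸-assoc; <-irrefl)
  renaming (+-identityʳ to +ℕ-identityʳ; ≤-refl to ≤ℕ-refl)
open import Data.Fin using (Fin; zero; suc) renaming (_≟_ to _≟F_)
open import Data.Fin.Properties using (suc-injective)
open import Data.Vec using (Vec; []; _∷_; lookup; tabulate)
open import Data.Vec.Properties using (lookup∘tabulate)
open import Relation.Nullary using (yes; no; ¬_; contradiction)
open import Relation.Binary.PropositionalEquality using (_≡_; refl; sym; trans; cong; cong₂; module ≡-Reasoning)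
open import Function using (_∘_)

xor-cancelʳ : ∀ a b → (a xor b) xor b ≡ a
xor-cancelʳ a b = trans (xor-assoc a b b) (trans (cong (a xor_) (xor-same b)) (xor-identityʳ a))

xor-telescope : ∀ a b c → (a xor b) xor (b xor c) ≡ a xor c
xor-telescope a b c = trans (sym (xor-assoc (a xor b) b c)) (cong (_xor c) (xor-cancelʳ a b))

xorFin-allFalse : ∀ n (f : Fin n → Bool) → (∀ v → f v ≡ false) → xorFin n f ≡ false
xorFin-allFalse zero    f f≡false = refl
xorFin-allFalse (suc n) f f≡false rewrite f≡false zero = xorFin-allFalse n (f ∘ suc) (f≡false ∘ suc)

xorFin-single : ∀ n (f : Fin n → Bool) a → (∀ v → ¬ v ≡ a → f v ≡ false) → xorFin n f ≡ f a
xorFin-single (suc n) f zero f≡false =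
  trans (cong (f zero xor_) (xorFin-allFalse n (f ∘ suc) (λ v → f≡false (suc v) λ ())))
        (xor-identityʳ (f zero))
xorFin-single (suc n) f (suc a) f≡false rewrite f≡false zero (λ ()) =
  xorFin-single n (f ∘ suc) a (λ v v≢a → f≡false (suc v) (v≢a ∘ suc-injective))

xorFin-select : ∀ n (f : Fin n → Bool) a → xorFin n (λ v → f v ∧ (a ≡ᵇ v)) ≡ f a
xorFin-select n f a = trans (xorFin-single n _ a off) on
  where
  off : ∀ v → ¬ v ≡ a → f v ∧ (a ≡ᵇ v) ≡ false
  off v v≢a with a ≟F v
  ... | yes a≡v = contradiction (sym a≡v) v≢a
  ... | no _    = ∧-zeroʳ (f v)
  on : f a ∧ (a ≡ᵇ a) ≡ f a
  on with a ≟F a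
  ... | yes _   = ∧-identityʳ (f a)
  ... | no a≢a  = contradiction refl a≢a

xorUpTo-cong : ∀ m (f g : ℕ → Bool) → (∀ j → f j ≡ g j) → xorUpTo m f ≡ xorUpTo m g
xorUpTo-cong zero    f g f≡g = refl
xorUpTo-cong (suc m) f g f≡g = cong₂ _xor_ (xorUpTo-cong m f g f≡g) (f≡g m)

sumFin-cong : ∀ n (f g : Fin n → ℚ) → (∀ v → f v ≡ g v) → sumFin n f ≡ sumFin n g
sumFin-cong zero    f g f≡g = refl
sumFin-cong (suc n) f g f≡g = cong₂ _+_ (f≡g zero) (sumFin-cong n (f ∘ suc) (g ∘ suc) (f≡g ∘ suc))

sumFin-allZero : ∀ n (f : Fin n → ℚ) → (∀ v → f v ≡ 0ℚ) → sumFin n f ≡ 0ℚ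
sumFin-allZero n f f≡0 = trans (sumFin-cong n f (λ _ → 0ℚ) f≡0) (zeros n)
  where
  zeros : ∀ n → sumFin n (λ _ → 0ℚ) ≡ 0ℚ
  zeros zero    = refl
  zeros (suc n) = cong (0ℚ +_) (zeros n)

sumUpTo-cong : ∀ m (f g : ℕ → ℚ) → (∀ j → j < m → f j ≡ g j) → sumUpTo m f ≡ sumUpTo m g
sumUpTo-cong zero    f g f≡g = refl
sumUpTo-cong (suc m) f g f≡g =
  cong₂ _+_ (sumUpTo-cong m f g (λ j j<m → f≡g j (m<n⇒m<1+n j<m))) (f≡g m ≤ℕ-refl)

ind-zero : ∀ b → ind b 0ℚ ≡ 0ℚ
ind-zero true  = refl
ind-zero false = refl

Fin1-allEqual : ∀ {n} → n ≡ 1 → (a b : Fin n) → a ≡ b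
Fin1-allEqual refl zero zero = refl

Searchable : Set → Set
Searchable A = (f : A → ℚ) → Σ A λ a → ∀ b → f a ≤ f b

search-⊤ : Searchable ⊤
search-⊤ f = tt , λ { tt → ≤-refl }

search-Bool : Searchable Bool
search-Bool f with ≤-total (f true) (f false)
... | inj₁ t≤f = true  , λ { true → ≤-refl ; false → t≤f }
... | inj₂ f≤t = false , λ { true → f≤t ; false → ≤-refl }

search-× : ∀ {A B} → Searchable A → Searchable B → Searchable (A × B)
search-× {A} {B} searchA searchB f =
  (a* , best a*) , λ { (a , b) → ≤-trans (proj₂ outer a) (proj₂ (searchB (λ b → f (a , b))) b) }
  where
  best : A → B
  best a = proj₁ (searchB (λ b → f (a , b)))
  outer : Σ A λ a* → ∀ a → f (a* , best a*) ≤ f (a , best a)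
  outer = searchA (λ a → f (a , best a))
  a* : A
  a* = proj₁ outer

search-Vec : ∀ n → Searchable (Vec Bool n)
search-Vec zero    f = [] , λ { [] → ≤-refl }
search-Vec (suc n) f with search-× search-Bool (search-Vec n) (λ (b , bs) → f (b ∷ bs))
... | (b , bs) , min = (b ∷ bs) , λ { (c ∷ cs) → min (c , cs) }

IsMin-fromSearch : ∀ {C A : Set} {P : A → Set} (f : A → ℚ) → Searchable C →
  (decode : C → A) → (∀ c → P (decode c)) → (∀ a → P a → Σ C λ c → f (decode c) ≡ f a) →
  ∃ λ m → IsMin P f m
IsMin-fromSearch {C} f search decode feasible matched =
  f (decode c*) , (decode c* , feasible c* , refl) ,
  λ a Pa → let (c , fc≡fa) = matched a Pa in ≤-trans (proj₂ min c) (≤-reflexive fc≡fa)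
  where
  min : Σ C λ c* → ∀ c → f (decode c*) ≤ f (decode c)
  min = search (f ∘ decode)
  c* : C
  c* = proj₁ min

IsMin-transport : ∀ {A B : Set} {P : A → Set} {Q : B → Set} {f : A → ℚ} {g : B → ℚ} {m : ℚ} →
  (to : A → B) → (∀ a → P a → Q (to a)) → (∀ a → g (to a) ≡ f a) →
  (from : B → A) → (∀ b → Q b → P (from b)) → (∀ b → f (from b) ≡ g b) →
  IsMin P f m → IsMin Q g m
IsMin-transport to to-feasible to-cost from from-feasible from-cost ((a , Pa , fa≡m) , lower) =
  (to a , to-feasible a Pa , trans (to-cost a) fa≡m) ,
  λ b Qb → ≤-trans (lower (from b) (from-feasible b Qb)) (≤-reflexive (from-cost b))

module _ (H : Hierarchy) where
  open Hierarchy H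

  deg-top : ∀ v → deg H L v ≡ 0ℚ
  deg-top v = sumFin-allZero (size L) _ no-edge
    where
    no-edge : ∀ u → wC H L v u ≡ 0ℚ
    no-edge u with v ≟F u
    ... | yes _   = refl
    ... | no v≢u  = contradiction (Fin1-allEqual top v u) v≢u

  levelCost : LevelSet H → ℕ → ℚ
  levelCost D j = sumFin (size j) (λ v → ind (D j v) (deg H j v))

  costD-belowTop : ∀ D → costD H D ≡ sumUpTo L (levelCost D)
  costD-belowTop D = trans (cong (sumUpTo L (levelCost D) +_) top-free) (+-identityʳ _)
    where
    top-free : levelCost D L ≡ 0ℚ
    top-free = sumFin-allZero (size L) _ λ v → trans (cong (ind (D L v)) (deg-top v)) (ind-zero (D L v))

  cutX-cong : ∀ A B → (∀ j → j ≤ℕ L → ∀ v → A j v ≡ B j v) → cutX H A ≡ cutX H B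
  cutX-cong A B A≡B = sumUpTo-cong L _ _ λ j j<L → sumFin-cong (size j) _ _ λ u →
    cong (λ b → ind b (deg H j u)) (cong₂ _xor_ (A≡B j (<⇒≤ j<L) u) (A≡B (suc j) j<L (π j u)))

  alongChain : LevelSet H → V H → ℕ → Bool
  alongChain D x j = D j (proj H j x)

  symDiff-alongChain : ∀ D x → symDiff H D x ≡ xorUpTo (suc L) (alongChain D x)
  symDiff-alongChain D x = xorUpTo-cong (suc L) _ _ λ j → xorFin-select (size j) (D j) (proj H j x)

  -- accumulateFor r D j v is the parity of D on v and its first r ancestors; accumulate takes
  -- r = L ∸ j, which reaches exactly up to the top level.
  accumulateFor : ℕ → LevelSet H → LevelSet H
  accumulateFor zero    D j v = D j v
  accumulateFor (suc r) D j v = D j v xor accumulateFor r D (suc j) (π j v)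

  accumulate : LevelSet H → LevelSet H
  accumulate D j v = accumulateFor (L ∸ j) D j v

  accumulate-below : ∀ D j v → j < L → accumulate D j v ≡ D j v xor accumulate D (suc j) (π j v)
  accumulate-below D j v j<L rewrite +-∸-assoc 1 j<L = refl

  accumulateFor-alongChain : ∀ D x r j →
    xorUpTo j (alongChain D x) xor accumulateFor r D j (proj H j x) ≡ xorUpTo (suc (r +ℕ j)) (alongChain D x)
  accumulateFor-alongChain D x zero    j = refl
  accumulateFor-alongChain D x (suc r) j =
    trans (sym (xor-assoc (xorUpTo j _) _ _))
      (trans (accumulateFor-alongChain D x r (suc j))
        (cong (λ n → xorUpTo (suc n) (alongChain D x)) (+-suc r j)))

  accumulate-feasible : ∀ S D → DFeasible H S D → SFeasible H S (accumulate D)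
  accumulate-feasible S D feasible x = begin
    accumulate D 0 x                        ≡⟨ accumulateFor-alongChain D x L 0 ⟩
    xorUpTo (suc (L +ℕ 0)) (alongChain D x) ≡⟨ cong (λ n → xorUpTo (suc n) (alongChain D x)) (+ℕ-identityʳ L) ⟩
    xorUpTo (suc L) (alongChain D x)        ≡⟨ sym (symDiff-alongChain D x) ⟩
    symDiff H D x                           ≡⟨ feasible x ⟩
    S x                                     ∎
    where open ≡-Reasoning

  accumulate-edge : ∀ D j u → j < L → accumulate D j u xor accumulate D (suc j) (π j u) ≡ D j u
  accumulate-edge D j u j<L = begin
    accumulate D j u xor above                ≡⟨ cong (_xor above) (accumulate-below D j u j<L) ⟩
    (D j u xor above) xor above               ≡⟨ xor-cancelʳ (D j u) above ⟩
    D j u                                     ∎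
    where
    open ≡-Reasoning
    above : Bool
    above = accumulate D (suc j) (π j u)

  accumulate-cost : ∀ D → cutX H (accumulate D) ≡ costD H D
  accumulate-cost D = trans (sumUpTo-cong L _ _ λ j j<L → sumFin-cong (size j) _ _ λ u →
                               cong (λ b → ind b (deg H j u)) (accumulate-edge D j u j<L))
                            (sym (costD-belowTop D))

  difference : LevelSet H → LevelSet H
  difference A j v with j <? L
  ... | yes _ = A j v xor A (suc j) (π j v)
  ... | no _  = A j v

  difference-below : ∀ A j v → j < L → difference A j v ≡ A j v xor A (suc j) (π j v)
  difference-below A j v j<L with j <? L
  ... | yes _   = refl
  ... | no j≮L  = contradiction j<L j≮L

  difference-top : ∀ A v → difference A L v ≡ A L v
  difference-top A v with L <? L
  ... | yes L<L = contradiction L<L (<-irrefl refl)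
  ... | no _    = refl

  difference-alongChain : ∀ A x m → m ≤ℕ L →
    xorUpTo m (alongChain (difference A) x) ≡ A 0 x xor A m (proj H m x)
  difference-alongChain A x zero    _    = sym (xor-same (A 0 x))
  difference-alongChain A x (suc m) m<L =
    trans (cong₂ _xor_ (difference-alongChain A x m (<⇒≤ m<L)) (difference-below A m (proj H m x) m<L))
          (xor-telescope (A 0 x) (A m (proj H m x)) (A (suc m) (proj H (suc m) x)))

  difference-feasible : ∀ S A → SFeasible H S A → DFeasible H S (difference A)
  difference-feasible S A feasible x = begin
    symDiff H (difference A) x                                  ≡⟨ symDiff-alongChain (difference A) x ⟩
    xorUpTo L (alongChain (difference A) x) xor difference A L top-x
                                                                ≡⟨ cong₂ _xor_ (difference-alongChain A x L ≤ℕ-refl)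
                                                                                (difference-top A top-x) ⟩
    (A 0 x xor A L top-x) xor A L top-x                         ≡⟨ xor-cancelʳ (A 0 x) (A L top-x) ⟩
    A 0 x                                                       ≡⟨ feasible x ⟩
    S x                                                         ∎
    where
    open ≡-Reasoning
    top-x : Fin (size L)
    top-x = proj H L x

  difference-cost : ∀ A → costD H (difference A) ≡ cutX H A
  difference-cost A = trans (costD-belowTop (difference A)) (sumUpTo-cong L _ _ λ j j<L →
    sumFin-cong (size j) _ _ λ u → cong (λ b → ind b (deg H j u)) (difference-below A j u j<L))

  -- Levels 1, …, k of a vertex set of X; level 0 is fixed to S and levels above k are empty.
  Profile : ℕ → Set
  Profile zero    = ⊤
  Profile (suc k) = Profile k × Vec Bool (size (suc k))

  search-Profile : ∀ k → Searchable (Profile k)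
  search-Profile zero    = search-⊤
  search-Profile (suc k) = search-× (search-Profile k) (search-Vec _)

  module _ (S : V H → Bool) where

    decode : ∀ k → Profile k → LevelSet H
    decode zero    _          zero    v = S v
    decode zero    _          (suc j) v = false
    decode (suc k) (bits , b) j       v with j ≟ℕ suc k
    ... | yes refl = lookup b v
    ... | no _     = decode k bits j v

    decode-feasible : ∀ k bits → SFeasible H S (decode k bits)
    decode-feasible zero    bits       x = refl
    decode-feasible (suc k) (bits , _) x = decode-feasible k bits x

    encode : ∀ k → LevelSet H → Profile k
    encode zero    A = tt
    encode (suc k) A = encode k A , tabulate (A (suc k))

    decode-encode : ∀ k A → SFeasible H S A → ∀ j → j ≤ℕ k → ∀ v → decode k (encode k A) j v ≡ A j v
    decode-encode zero    A feasible zero z≤n v = sym (feasible v)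
    decode-encode (suc k) A feasible j j≤k v with j ≟ℕ suc k
    ... | yes refl = lookup∘tabulate (A (suc k)) v
    ... | no j≢k   = decode-encode k A feasible j (≤-pred (≤∧≢⇒< j≤k j≢k)) v

    cutX-minimum : ∃ λ m → IsMin (SFeasible H S) (cutX H) m
    cutX-minimum = IsMin-fromSearch (cutX H) (search-Profile L) (decode L) (decode-feasible L)
      λ A feasible → encode L A , cutX-cong _ A (decode-encode L A feasible)

mainTheorem12 : (H : Hierarchy) (S : V H → Bool) →
    ∃ λ (m : ℚ) → IsMin (DFeasible H S) (costD H) m
    × IsMin (SFeasible H S) (cutX H) m
mainTheorem12 H S =
  let (m , cutMin) = cutX-minimum H S in
  m , IsMin-transport (difference H) (difference-feasible H S) (difference-cost H)
                      (accumulate H) (accumulate-feasible H S) (accumulate-cost H) cutMin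
    , cutMin
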